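{- Let $m$ be a positive integer and let $\beta \in S_{2m}$ be a permutation with exactly $m$ fixed points. Then \begin{enumerate} \item $c(2m, \beta)=(m!)^2$; \item $c(2m-1, \beta)=m^2(m!)^2$. \end{enumerate}
   Context: $S_n$ is the group of permutations of $[n]=\{1,\dots,n\}$; products are composed right to left. The Hamming distance between $\sigma,\tau\in S_n$ is $H(\sigma,\tau)=|\{a\in[n]:\sigma(a)\neq\tau(a)\}|$. Two permutations $\alpha,\beta\in S_n$ $k$-commute if $H(\alpha\beta,\beta\alpha)=k$. For $\beta\in S_n$ and a nonnegative integer $k$, $c(k,\beta)$ denotes the number of $\alpha\in S_n$ that $k$-commute with $\beta$. -}

module Defs where

open import Data.Nat using (ℕ; zero; suc; _*_; _≟_)
open import Data.Fin using (Fin)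
import Data.Fin as F
open import Data.Fin.Permutation using (Permutation′; _⟨$⟩ʳ_)
open import Data.Vec using (Vec; []; _∷_; lookup; tabulate)
open import Data.List using (List; []; _∷_; map; concatMap; length; filter; allFin)
open import Data.List.Relation.Unary.All using (All)
open import Data.List.Relation.Unary.All using (all?)
open import Relation.Nullary using (Dec; ¬_)
open import Relation.Nullary.Decidable using (¬?; _×-dec_; _→-dec_)
open import Relation.Binary.PropositionalEquality using (_≡_)
open import Function using (_∘_)

count : ∀ {a} {A : Set a} {P : A → Set} → (∀ x → Dec (P x)) → List A → ℕ
count P? xs = length (filter P? xs)

hamming : ∀ {n} → (Fin n → Fin n) → (Fin n → Fin n) → ℕ
hamming {n} σ τ = count (λ a → ¬? (σ a F.≟ τ a)) (allFin n)

allVecs : (n k : ℕ) → List (Vec (Fin n) k)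
allVecs n zero = [] ∷ []
allVecs n (suc k) = concatMap (λ x → map (x ∷_) (allVecs n k)) (allFin n)

-- A table is a permutation of [n] iff it is injective.
IsPerm : ∀ {n} → Vec (Fin n) n → Set
IsPerm {n} v = All (λ i → All (λ j → lookup v i ≡ lookup v j → i ≡ j) (allFin n)) (allFin n)

-- Two permutations α, β k-commute iff H(αβ, βα) = k (composition right to left).
KCommute : ∀ {n} → ℕ → Vec (Fin n) n → Permutation′ n → Set
KCommute k α β = hamming (λ a → lookup α (β ⟨$⟩ʳ a)) (λ a → β ⟨$⟩ʳ (lookup α a)) ≡ k

isPerm? : ∀ {n} (v : Vec (Fin n) n) → Dec (IsPerm v)
isPerm? {n} v = all? (λ i → all? (λ j → (lookup v i F.≟ lookup v j) →-dec (i F.≟ j)) (allFin n)) (allFin n)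

kcommute? : ∀ {n} (k : ℕ) (α : Vec (Fin n) n) (β : Permutation′ n) → Dec (KCommute k α β)
kcommute? k α β = _ ≟ k

c : ∀ {n} → ℕ → Permutation′ n → ℕ
c {n} k β = count (λ α → isPerm? α ×-dec kcommute? k α β) (allVecs n n)

fixedPoints : ∀ {n} → Permutation′ n → ℕ
fixedPoints {n} β = count (λ a → (β ⟨$⟩ʳ a) F.≟ a) (allFin n)

module Submission where

-- Call i an agreement point of α and β if α (β i) = β (α i); then H(αβ, βα) is n minus the
-- number of agreement points, so we count the permutations α with no agreement point, resp.
-- exactly one. Colour each point i by whether α i is fixed by β. A fixed point i agrees iff
-- α i is fixed; a moved point i never agrees if α i is fixed, nor if α i is moved but α (β i)
-- is fixed. As α permutes the points, the fixed points sent to fixed points are as many as the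
-- moved points sent to moved points. Hence α has no agreement point iff its colouring is
-- "moved" (fixed and moved points are exchanged), and exactly one iff its colouring is that
-- pattern altered at one fixed point a and one moved point a′, the pair (a, a′) being unique.
-- Finally, the permutations with a prescribed colouring having m points of each colour number
-- m! · m!: the images of each colour class are chosen one at a time.

open import Data.Bool using (Bool; true; false; _∧_; not; if_then_else_)
open import Data.Bool.Properties using (⇔→≡; not-injective; ∧-identityʳ; ∧-assoc; ∧-comm; ∧-zeroʳ; ∧-conicalˡ; ∧-conicalʳ; not-involutive)
open import Data.Empty using (⊥-elim)
open import Data.Fin using (Fin; zero; suc)
import Data.Fin.Properties as FinP
open import Data.Fin.Permutation using (Permutation′; _⟨$⟩ʳ_; _⟨$⟩ˡ_; inverseˡ)
open import Data.List using (List; []; _∷_; map; concatMap; length; allFin; _++_)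
open import Data.List.Membership.Propositional using (_∈_)
open import Data.List.Membership.Propositional.Properties using (∈-allFin)
open import Data.List.Properties using (length-tabulate; map-tabulate)
open import Data.List.Relation.Unary.Any using (here; there)
import Data.List.Relation.Unary.All as All
open import Data.Nat using (ℕ; zero; suc; _+_; _*_; _∸_; _≤_; z≤n; s≤s; _!)
open import Data.Nat.Properties
open import Data.Vec.Properties using (lookup∘tabulate)
open import Data.Product using (Σ; _×_; _,_; proj₁; proj₂)
open import Data.Vec using (Vec; []; _∷_; lookup; toList)
import Data.Vec as Vec
open import Function using (_∘_; id)
open import Function.Definitions using (Injective)
open import Function.Bundles using (_⇔_; mk⇔; Equivalence)
open import Relation.Binary.PropositionalEquality
open import Relation.Nullary using (Dec; yes; no; ¬_; does; contradiction; _×-dec_)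
open import Relation.Nullary.Decidable using (dec-true; dec-false)

open import Algebra.Properties.CommutativeSemigroup +-commutativeSemigroup
  using () renaming (x∙yz≈y∙xz to x+[y+z]≡y+[x+z])
open import Algebra.Properties.CommutativeSemigroup *-commutativeSemigroup
  using () renaming (x∙yz≈y∙xz to x*[y*z]≡y*[x*z])

open import Defs

open ≡-Reasoning

ind : Bool → ℕ
ind true  = 1
ind false = 0

cnt : ∀ {a} {A : Set a} → (A → Bool) → List A → ℕ
cnt g []       = 0
cnt g (x ∷ xs) = ind (g x) + cnt g xs

∑ : ∀ {a} {A : Set a} → List A → (A → ℕ) → ℕ
∑ []       F = 0
∑ (x ∷ xs) F = F x + ∑ xs F

does-true : ∀ {P : Set} (P? : Dec P) → does P? ≡ true → P
does-true (yes p) _ = p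

∧-true : ∀ {a b} → a ≡ true → b ≡ true → a ∧ b ≡ true
∧-true refl refl = refl

module _ {a} {A : Set a} where

  count≡cnt : {P : A → Set} (P? : ∀ x → Dec (P x)) (xs : List A) →
              count P? xs ≡ cnt (λ x → does (P? x)) xs
  count≡cnt P? [] = refl
  count≡cnt P? (x ∷ xs) with does (P? x)
  ... | true  = cong suc (count≡cnt P? xs)
  ... | false = count≡cnt P? xs

  cnt-cong : {g h : A → Bool} → (∀ x → g x ≡ h x) → (xs : List A) → cnt g xs ≡ cnt h xs
  cnt-cong e []       = refl
  cnt-cong e (x ∷ xs) = cong₂ _+_ (cong ind (e x)) (cnt-cong e xs)

  ∑-cong : {F G : A → ℕ} → (∀ x → F x ≡ G x) → (xs : List A) → ∑ xs F ≡ ∑ xs G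
  ∑-cong e []       = refl
  ∑-cong e (x ∷ xs) = cong₂ _+_ (e x) (∑-cong e xs)

  cnt≡∑ : (g : A → Bool) (xs : List A) → cnt g xs ≡ ∑ xs (ind ∘ g)
  cnt≡∑ g []       = refl
  cnt≡∑ g (x ∷ xs) = cong (ind (g x) +_) (cnt≡∑ g xs)

  ∑-+ : (F G : A → ℕ) (xs : List A) → ∑ xs (λ x → F x + G x) ≡ ∑ xs F + ∑ xs G
  ∑-+ F G []       = refl
  ∑-+ F G (x ∷ xs) = begin
    (F x + G x) + ∑ xs (λ y → F y + G y) ≡⟨ cong (F x + G x +_) (∑-+ F G xs) ⟩
    (F x + G x) + (∑ xs F + ∑ xs G)      ≡⟨ +-assoc (F x) (G x) _ ⟩
    F x + (G x + (∑ xs F + ∑ xs G))      ≡⟨ cong (F x +_) (x+[y+z]≡y+[x+z] (G x) (∑ xs F) (∑ xs G)) ⟩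
    F x + (∑ xs F + (G x + ∑ xs G))      ≡⟨ +-assoc (F x) (∑ xs F) _ ⟨
    (F x + ∑ xs F) + (G x + ∑ xs G)      ∎

  ∑-zero : {F : A → ℕ} → (∀ x → F x ≡ 0) → (xs : List A) → ∑ xs F ≡ 0
  ∑-zero z []       = refl
  ∑-zero z (x ∷ xs) = cong₂ _+_ (z x) (∑-zero z xs)

  ∑-indicator : (g : A → Bool) {F : A → ℕ} (C : ℕ) →
                (∀ x → g x ≡ true → F x ≡ C) → (∀ x → g x ≡ false → F x ≡ 0) →
                (xs : List A) → ∑ xs F ≡ cnt g xs * C
  ∑-indicator g C on off []       = refl
  ∑-indicator g C on off (x ∷ xs) with g x in gx
  ... | true  = cong₂ _+_ (on x gx) (∑-indicator g C on off xs)
  ... | false = cong₂ _+_ (off x gx) (∑-indicator g C on off xs)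

  ∑-if : (g : A → Bool) (G : A → ℕ) (C : ℕ) → (∀ x → g x ≡ true → G x ≡ C) →
         (xs : List A) → ∑ xs (λ x → if g x then G x else 0) ≡ cnt g xs * C
  ∑-if g G C on = ∑-indicator g C on′ off
    where
    on′ : ∀ x → g x ≡ true → (if g x then G x else 0) ≡ C
    on′ x gx rewrite gx = on x gx
    off : ∀ x → g x ≡ false → (if g x then G x else 0) ≡ 0
    off x gx rewrite gx = refl

  cnt-split : (h g : A → Bool) (xs : List A) →
              cnt g xs ≡ cnt (λ x → h x ∧ g x) xs + cnt (λ x → not (h x) ∧ g x) xs
  cnt-split h g []       = refl
  cnt-split h g (x ∷ xs) with h x | g x
  ... | true  | true  = cong suc (cnt-split h g xs)
  ... | true  | false = cnt-split h g xs
  ... | false | true  = trans (cong suc (cnt-split h g xs)) (sym (+-suc _ _))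
  ... | false | false = cnt-split h g xs

  cnt-total : (g : A → Bool) (xs : List A) → cnt g xs + cnt (not ∘ g) xs ≡ length xs
  cnt-total g []       = refl
  cnt-total g (x ∷ xs) with g x
  ... | true  = cong suc (cnt-total g xs)
  ... | false = trans (+-suc _ _) (cong suc (cnt-total g xs))

  cnt-mono : {g h : A → Bool} → (∀ x → g x ≡ true → h x ≡ true) → (xs : List A) → cnt g xs ≤ cnt h xs
  cnt-mono imp [] = z≤n
  cnt-mono {g} {h} imp (x ∷ xs) with g x in gx | h x in hx
  ... | false | false = cnt-mono imp xs
  ... | false | true  = m≤n⇒m≤1+n (cnt-mono imp xs)
  ... | true  | true  = s≤s (cnt-mono imp xs)
  ... | true  | false with () ← trans (sym (imp x gx)) hx

  cnt-∧const : (b : Bool) (h : A → Bool) (xs : List A) →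
               cnt (λ x → b ∧ h x) xs ≡ (if b then cnt h xs else 0)
  cnt-∧const true  h xs = refl
  cnt-∧const false h xs = trans (cnt≡∑ (λ _ → false) xs) (∑-zero (λ _ → refl) xs)

  cnt-none : {g : A → Bool} → (∀ x → g x ≡ false) → (xs : List A) → cnt g xs ≡ 0
  cnt-none none []       = refl
  cnt-none none (x ∷ xs) = cong₂ _+_ (cong ind (none x)) (cnt-none none xs)

  cnt-∧-true : ∀ {b} (h : A → Bool) (xs : List A) → b ≡ true → cnt (λ x → b ∧ h x) xs ≡ cnt h xs
  cnt-∧-true h xs refl = refl

  cnt-∧-false : ∀ {b} (h : A → Bool) (xs : List A) → b ≡ false → cnt (λ x → b ∧ h x) xs ≡ 0
  cnt-∧-false h xs refl = cnt-∧const false h xs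

  cnt-zero : (g : A → Bool) (xs : List A) → cnt g xs ≡ 0 → ∀ {x} → x ∈ xs → g x ≡ false
  cnt-zero g (y ∷ xs) e (here refl) with g y
  ... | false = refl
  cnt-zero g (y ∷ xs) e (there x∈) with g y
  ... | false = cnt-zero g xs e x∈

  cnt-witness : (g : A → Bool) (xs : List A) {k : ℕ} → cnt g xs ≡ suc k → Σ A λ x → g x ≡ true
  cnt-witness g (y ∷ xs) e with g y in gy
  ... | true  = y , gy
  ... | false = cnt-witness g xs e

  cnt-concatMap : {B : Set a} (g : A → Bool) (G : B → List A) (ys : List B) →
                  cnt g (concatMap G ys) ≡ ∑ ys (λ y → cnt g (G y))
  cnt-concatMap g G []       = refl
  cnt-concatMap g G (y ∷ ys) = trans (cnt-++ (G y) _) (cong (cnt g (G y) +_) (cnt-concatMap g G ys))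
    where
    cnt-++ : (xs zs : List A) → cnt g (xs ++ zs) ≡ cnt g xs + cnt g zs
    cnt-++ []       zs = refl
    cnt-++ (x ∷ xs) zs = trans (cong (ind (g x) +_) (cnt-++ xs zs)) (sym (+-assoc (ind (g x)) _ _))

  cnt-map : {B : Set a} (g : A → Bool) (h : B → A) (ys : List B) → cnt g (map h ys) ≡ cnt (g ∘ h) ys
  cnt-map g h []       = refl
  cnt-map g h (y ∷ ys) = cong (ind (g (h y)) +_) (cnt-map g h ys)

  ∑-map : {B : Set a} (F : A → ℕ) (h : B → A) (ys : List B) → ∑ (map h ys) F ≡ ∑ ys (F ∘ h)
  ∑-map F h []       = refl
  ∑-map F h (y ∷ ys) = cong (F (h y) +_) (∑-map F h ys)

∑-swap : ∀ {a} {A B : Set a} (xs : List A) (ys : List B) (G : B → A → ℕ) →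
         ∑ xs (λ x → ∑ ys (λ y → G y x)) ≡ ∑ ys (λ y → ∑ xs (G y))
∑-swap []       ys G = sym (∑-zero (λ _ → refl) ys)
∑-swap (x ∷ xs) ys G = trans (cong (∑ ys (λ y → G y x) +_) (∑-swap xs ys G))
                             (sym (∑-+ (λ y → G y x) (λ y → ∑ xs (G y)) ys))

eqF : ∀ {n} → Fin n → Fin n → Bool
eqF x y = does (x FinP.≟ y)

eqF-refl : ∀ {n} (x : Fin n) → eqF x x ≡ true
eqF-refl x = dec-true (x FinP.≟ x) refl

eqF-false : ∀ {n} {x y : Fin n} → x ≢ y → eqF x y ≡ false
eqF-false {x = x} {y} = dec-false (x FinP.≟ y)

eqF-true : ∀ {n} {x y : Fin n} → eqF x y ≡ true → x ≡ y
eqF-true {x = x} {y} e with x FinP.≟ y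
... | yes x≡y = x≡y

eqF-sym : ∀ {n} (x y : Fin n) → eqF x y ≡ eqF y x
eqF-sym x y with x FinP.≟ y
... | yes refl = sym (eqF-refl x)
... | no x≢y   = sym (eqF-false (x≢y ∘ sym))

length-allFin : ∀ n → length (allFin n) ≡ n
length-allFin n = length-tabulate id

∑-allFin-suc : ∀ {n} (F : Fin (suc n) → ℕ) → ∑ (allFin (suc n)) F ≡ F zero + ∑ (allFin n) (F ∘ suc)
∑-allFin-suc {n} F =
  cong (F zero +_) (trans (cong (λ ys → ∑ ys F) (sym (map-tabulate id suc))) (∑-map F suc (allFin n)))

∑-single : ∀ {n} (F : Fin n → ℕ) (j₀ : Fin n) → (∀ j → j ≢ j₀ → F j ≡ 0) → ∑ (allFin n) F ≡ F j₀
∑-single F zero off = begin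
  ∑ (allFin _) F                       ≡⟨ ∑-allFin-suc F ⟩
  F zero + ∑ (allFin _) (F ∘ suc)      ≡⟨ cong (F zero +_) (∑-zero (λ j → off (suc j) λ ()) (allFin _)) ⟩
  F zero + 0                           ≡⟨ +-identityʳ (F zero) ⟩
  F zero                               ∎
∑-single F (suc j₀) off = begin
  ∑ (allFin _) F                       ≡⟨ ∑-allFin-suc F ⟩
  F zero + ∑ (allFin _) (F ∘ suc)      ≡⟨ cong₂ _+_ (off zero λ ()) (∑-single (F ∘ suc) j₀ off′) ⟩
  F (suc j₀)                           ∎
  where
  off′ : ∀ j → j ≢ j₀ → F (suc j) ≡ 0
  off′ j j≢j₀ = off (suc j) (j≢j₀ ∘ FinP.suc-injective)

module _ {p q} {X : Set} (P : X → Bool) (Q : Fin p → Fin q → X → Bool)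
         (cover : ∀ x → P x ≡ true → Σ (Fin p) λ j → Σ (Fin q) λ k → Q j k x ≡ true)
         (sound : ∀ {j k x} → Q j k x ≡ true → P x ≡ true)
         (unique : ∀ {j k j′ k′ x} → Q j k x ≡ true → Q j′ k′ x ≡ true → j ≡ j′ × k ≡ k′) where

  ind-partition : ∀ x → ind (P x) ≡ ∑ (allFin p) (λ j → ∑ (allFin q) (λ k → ind (Q j k x)))
  ind-partition x with P x in Px
  ... | false = sym (∑-zero (λ j → ∑-zero (λ k → offPair j k) (allFin q)) (allFin p))
    where
    offPair : ∀ j k → ind (Q j k x) ≡ 0
    offPair j k with Q j k x in e
    ... | true  = contradiction (trans (sym (sound e)) Px) λ ()
    ... | false = refl
  ... | true  with cover x Px
  ...   | j₀ , k₀ , hit = sym (trans (∑-single _ j₀ offRow) (trans (∑-single _ k₀ offColumn) (cong ind hit)))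
    where
    offEntry : ∀ j k → ¬ (j ≡ j₀ × k ≡ k₀) → ind (Q j k x) ≡ 0
    offEntry j k other with Q j k x in e
    ... | true  = contradiction (unique e hit) other
    ... | false = refl
    offRow : ∀ j → j ≢ j₀ → ∑ (allFin q) (λ k → ind (Q j k x)) ≡ 0
    offRow j j≢j₀ = ∑-zero (λ k → offEntry j k (j≢j₀ ∘ proj₁)) (allFin q)
    offColumn : ∀ k → k ≢ k₀ → ind (Q j₀ k x) ≡ 0
    offColumn k k≢k₀ = offEntry j₀ k (k≢k₀ ∘ proj₂)

  cnt-partition : (xs : List X) → cnt P xs ≡ ∑ (allFin p) (λ j → ∑ (allFin q) (λ k → cnt (Q j k) xs))
  cnt-partition xs = begin
    cnt P xs
      ≡⟨ cnt≡∑ P xs ⟩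
    ∑ xs (ind ∘ P)
      ≡⟨ ∑-cong ind-partition xs ⟩
    ∑ xs (λ x → ∑ (allFin p) (λ j → ∑ (allFin q) (λ k → ind (Q j k x))))
      ≡⟨ ∑-swap xs (allFin p) (λ j x → ∑ (allFin q) (λ k → ind (Q j k x))) ⟩
    ∑ (allFin p) (λ j → ∑ xs (λ x → ∑ (allFin q) (λ k → ind (Q j k x))))
      ≡⟨ ∑-cong (λ j → ∑-swap xs (allFin q) (λ k x → ind (Q j k x))) (allFin p) ⟩
    ∑ (allFin p) (λ j → ∑ (allFin q) (λ k → ∑ xs (ind ∘ Q j k)))
      ≡⟨ ∑-cong (λ j → ∑-cong (λ k → sym (cnt≡∑ (Q j k) xs)) (allFin q)) (allFin p) ⟩
    ∑ (allFin p) (λ j → ∑ (allFin q) (λ k → cnt (Q j k) xs))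
      ∎

cnt-single : ∀ {n} (g : Fin n → Bool) (x : Fin n) → g x ≡ true → (∀ y → g y ≡ true → y ≡ x) →
             cnt g (allFin n) ≡ 1
cnt-single g x gx unique = begin
  cnt g (allFin _)     ≡⟨ cnt≡∑ g (allFin _) ⟩
  ∑ (allFin _) (ind ∘ g) ≡⟨ ∑-single (ind ∘ g) x off ⟩
  ind (g x)            ≡⟨ cong ind gx ⟩
  1                    ∎
  where
  off : ∀ y → y ≢ x → ind (g y) ≡ 0
  off y y≢x with g y in gy
  ... | true  = ⊥-elim (y≢x (unique y gy))
  ... | false = refl

cnt-remove : ∀ {n} (h : Fin n → Bool) (x : Fin n) →
             cnt (λ y → not (eqF y x) ∧ h y) (allFin n) + ind (h x) ≡ cnt h (allFin n)
cnt-remove {n} h x = begin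
  cnt (λ y → not (eqF y x) ∧ h y) (allFin _) + ind (h x)
    ≡⟨ +-comm _ (ind (h x)) ⟩
  ind (h x) + cnt (λ y → not (eqF y x) ∧ h y) (allFin _)
    ≡⟨ cong (_+ cnt (λ y → not (eqF y x) ∧ h y) (allFin _)) (sym atX) ⟩
  cnt (λ y → eqF y x ∧ h y) (allFin _) + cnt (λ y → not (eqF y x) ∧ h y) (allFin _)
    ≡⟨ cnt-split (λ y → eqF y x) h (allFin _) ⟨
  cnt h (allFin _)
    ∎
  where
  off : ∀ y → y ≢ x → ind (eqF y x ∧ h y) ≡ 0
  off y y≢x rewrite eqF-false y≢x = refl
  atX : cnt (λ y → eqF y x ∧ h y) (allFin _) ≡ ind (h x)
  atX = trans (cnt≡∑ (λ y → eqF y x ∧ h y) (allFin n))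
              (trans (∑-single (λ y → ind (eqF y x ∧ h y)) x off) (cong (λ b → ind (b ∧ h x)) (eqF-refl x)))

cnt≡1-indicator : ∀ {n} (g : Fin n → Bool) → cnt g (allFin n) ≡ 1 →
                  ∀ {a} → g a ≡ true → ∀ y → g y ≡ eqF y a
cnt≡1-indicator {n} g once {a} ga y with y FinP.≟ a
... | yes refl = ga
... | no  y≢a  = trans (sym (cong (λ b → not b ∧ g y) (eqF-false y≢a))) othersFail
  where
  rest : ℕ
  rest = cnt (λ z → not (eqF z a) ∧ g z) (allFin n)
  rest≡0 : rest ≡ 0
  rest≡0 = +-cancelʳ-≡ 1 rest 0 (trans (cong (λ b → rest + ind b) (sym ga)) (trans (cnt-remove g a) once))
  othersFail : not (eqF y a) ∧ g y ≡ false
  othersFail = cnt-zero (λ z → not (eqF z a) ∧ g z) (allFin n) rest≡0 (∈-allFin y)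

cnt-allFin-suc : ∀ {n} (g : Fin (suc n) → Bool) → cnt g (allFin (suc n)) ≡ ind (g zero) + cnt (g ∘ suc) (allFin n)
cnt-allFin-suc {n} g =
  cong (ind (g zero) +_) (trans (cong (cnt g) (sym (map-tabulate id suc))) (cnt-map g suc (allFin n)))

cnt-toList : ∀ {a} {A : Set a} {k} (g : A → Bool) (v : Vec A k) →
             cnt g (toList v) ≡ cnt (g ∘ lookup v) (allFin k)
cnt-toList g []      = refl
cnt-toList g (x ∷ v) = trans (cong (ind (g x) +_) (cnt-toList g v)) (sym (cnt-allFin-suc (g ∘ lookup (x ∷ v))))

cnt-toList-tabulate : ∀ {a} {A : Set a} {k} (g : A → Bool) (f : Fin k → A) →
                      cnt g (toList (Vec.tabulate f)) ≡ cnt (g ∘ f) (allFin k)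
cnt-toList-tabulate {k = k} g f =
  trans (cnt-toList g (Vec.tabulate f)) (cnt-cong (λ i → cong g (lookup∘tabulate f i)) (allFin k))

falling : ℕ → ℕ → ℕ
falling p zero    = 1
falling p (suc t) = p * falling (p ∸ 1) t

falling-! : ∀ m → falling m m ≡ m !
falling-! zero    = refl
falling-! (suc m) = cong (suc m *_) (falling-! m)

sameAs : Bool → Bool → Bool
sameAs l b = if l then b else not b

module Tables {n : ℕ} where

  notIn : Fin n → List (Fin n) → Bool
  notIn y []      = true
  notIn y (x ∷ E) = not (eqF y x) ∧ notIn y E

  distinct : ∀ {k} → List (Fin n) → Vec (Fin n) k → Bool
  distinct E []      = true
  distinct E (y ∷ v) = notIn y E ∧ distinct (y ∷ E) v

  available : (Fin n → Bool) → List (Fin n) → ℕ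
  available g E = cnt (λ y → notIn y E ∧ g y) (allFin n)

  available-step : ∀ g E x → notIn x E ≡ true → available g (x ∷ E) + ind (g x) ≡ available g E
  available-step g E x x∉E = begin
    available g (x ∷ E) + ind (g x)
      ≡⟨ cong (_+ ind (g x)) (cnt-cong (λ y → ∧-assoc (not (eqF y x)) (notIn y E) (g y)) (allFin n)) ⟩
    cnt (λ y → not (eqF y x) ∧ (notIn y E ∧ g y)) (allFin n) + ind (g x)
      ≡⟨ cong (λ b → cnt (λ y → not (eqF y x) ∧ (notIn y E ∧ g y)) (allFin n) + ind (b ∧ g x)) x∉E ⟨
    cnt (λ y → not (eqF y x) ∧ (notIn y E ∧ g y)) (allFin n) + ind (notIn x E ∧ g x)
      ≡⟨ cnt-remove (λ y → notIn y E ∧ g y) x ⟩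
    available g E
      ∎

  available-used : ∀ g E x → notIn x E ≡ true → g x ≡ true → available g (x ∷ E) ≡ available g E ∸ 1
  available-used g E x x∉E gx =
    trans (sym (m+n∸n≡m (available g (x ∷ E)) 1))
          (cong (_∸ 1) (trans (cong (λ b → available g (x ∷ E) + ind b) (sym gx)) (available-step g E x x∉E)))

  available-unused : ∀ g E x → notIn x E ≡ true → g x ≡ false → available g (x ∷ E) ≡ available g E
  available-unused g E x x∉E gx =
    trans (sym (+-identityʳ (available g (x ∷ E))))
          (trans (cong (λ b → available g (x ∷ E) + ind b) (sym gx)) (available-step g E x x∉E))

  module _ (col : Fin n → Bool) where

    coloured : ∀ {k} → Vec Bool k → Vec (Fin n) k → Bool
    coloured []       []      = true
    coloured (l ∷ ls) (x ∷ v) = sameAs l (col x) ∧ coloured ls v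

    first-entry : ∀ {k} (l : Bool) (ls : Vec Bool k) (E : List (Fin n)) →
                  cnt (λ v → distinct E v ∧ coloured (l ∷ ls) v) (allVecs n (suc k))
                  ≡ ∑ (allFin n) (λ x → if notIn x E ∧ sameAs l (col x)
                                         then cnt (λ v → distinct (x ∷ E) v ∧ coloured ls v) (allVecs n k)
                                         else 0)
    first-entry {k} l ls E = begin
      cnt F (allVecs n (suc k))
        ≡⟨ cnt-concatMap F (λ x → map (x ∷_) (allVecs n k)) (allFin n) ⟩
      ∑ (allFin n) (λ x → cnt F (map (x ∷_) (allVecs n k)))
        ≡⟨ ∑-cong (λ x → cnt-map F (x ∷_) (allVecs n k)) (allFin n) ⟩
      ∑ (allFin n) (λ x → cnt (λ v → F (x ∷ v)) (allVecs n k))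
        ≡⟨ ∑-cong (λ x → cnt-cong (shuffle x) (allVecs n k)) (allFin n) ⟩
      ∑ (allFin n) (λ x → cnt (λ v → (notIn x E ∧ sameAs l (col x)) ∧ rest x v) (allVecs n k))
        ≡⟨ ∑-cong (λ x → cnt-∧const (notIn x E ∧ sameAs l (col x)) (rest x) (allVecs n k)) (allFin n) ⟩
      _ ∎
      where
      F : Vec (Fin n) (suc k) → Bool
      F v = distinct E v ∧ coloured (l ∷ ls) v
      rest : Fin n → Vec (Fin n) k → Bool
      rest x v = distinct (x ∷ E) v ∧ coloured ls v
      shuffle : ∀ x v → F (x ∷ v) ≡ (notIn x E ∧ sameAs l (col x)) ∧ rest x v
      shuffle x v with notIn x E | sameAs l (col x)
      ... | true  | true  = refl
      ... | true  | false = ∧-zeroʳ (distinct (x ∷ E) v)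
      ... | false | _     = refl

    -- Tables of length k with distinct entries outside E and colour pattern ls: the entries
    -- of colour true and those of colour false are chosen independently, one after another.
    count-coloured : ∀ {k} (ls : Vec Bool k) (E : List (Fin n)) →
                     cnt (λ v → distinct E v ∧ coloured ls v) (allVecs n k)
                     ≡ falling (available col E) (cnt id (toList ls))
                       * falling (available (not ∘ col) E) (cnt not (toList ls))
    count-coloured []          E = refl
    count-coloured (true ∷ ls) E = begin
      cnt (λ v → distinct E v ∧ coloured (true ∷ ls) v) (allVecs n _)
        ≡⟨ first-entry true ls E ⟩
      ∑ (allFin n) (λ x → if notIn x E ∧ col x then cnt (rest x) (allVecs n _) else 0)
        ≡⟨ ∑-if (λ x → notIn x E ∧ col x) (λ x → cnt (rest x) (allVecs n _)) C on (allFin n) ⟩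
      available col E * (falling (available col E ∸ 1) t * falling (available (not ∘ col) E) f)
        ≡⟨ *-assoc (available col E) _ _ ⟨
      falling (available col E) (suc t) * falling (available (not ∘ col) E) f
        ∎
      where
      t f C : ℕ
      t = cnt id (toList ls)
      f = cnt not (toList ls)
      C = falling (available col E ∸ 1) t * falling (available (not ∘ col) E) f
      rest : Fin n → Vec (Fin n) _ → Bool
      rest x v = distinct (x ∷ E) v ∧ coloured ls v
      on : ∀ x → notIn x E ∧ col x ≡ true → cnt (rest x) (allVecs n _) ≡ C
      on x e = trans (count-coloured ls (x ∷ E))
        (cong₂ (λ p q → falling p t * falling q f)
               (available-used col E x x∉E cx) (available-unused (not ∘ col) E x x∉E (cong not cx)))
        where
        x∉E = ∧-conicalˡ (notIn x E) (col x) e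
        cx  = ∧-conicalʳ (notIn x E) (col x) e
    count-coloured (false ∷ ls) E = begin
      cnt (λ v → distinct E v ∧ coloured (false ∷ ls) v) (allVecs n _)
        ≡⟨ first-entry false ls E ⟩
      ∑ (allFin n) (λ x → if notIn x E ∧ not (col x) then cnt (rest x) (allVecs n _) else 0)
        ≡⟨ ∑-if (λ x → notIn x E ∧ not (col x)) (λ x → cnt (rest x) (allVecs n _)) C on (allFin n) ⟩
      available (not ∘ col) E * (falling (available col E) t * falling (available (not ∘ col) E ∸ 1) f)
        ≡⟨ x*[y*z]≡y*[x*z] (available (not ∘ col) E) (falling (available col E) t) _ ⟩
      falling (available col E) t * falling (available (not ∘ col) E) (suc f)
        ∎
      where
      t f C : ℕ
      t = cnt id (toList ls)
      f = cnt not (toList ls)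
      C = falling (available col E) t * falling (available (not ∘ col) E ∸ 1) f
      rest : Fin n → Vec (Fin n) _ → Bool
      rest x v = distinct (x ∷ E) v ∧ coloured ls v
      on : ∀ x → notIn x E ∧ not (col x) ≡ true → cnt (rest x) (allVecs n _) ≡ C
      on x e = trans (count-coloured ls (x ∷ E))
        (cong₂ (λ p q → falling p t * falling q f)
               (available-unused col E x x∉E cx) (available-used (not ∘ col) E x x∉E (cong not cx)))
        where
        x∉E = ∧-conicalˡ (notIn x E) (not (col x)) e
        cx : col x ≡ false
        cx = trans (sym (not-involutive (col x))) (cong not (∧-conicalʳ (notIn x E) (not (col x)) e))

  distinct-bound : ∀ {k} (g : Fin n → Bool) (E : List (Fin n)) (v : Vec (Fin n) k) →
                   distinct E v ≡ true → cnt g (toList v) ≤ available g E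
  distinct-bound g E []      _ = z≤n
  distinct-bound g E (x ∷ v) d =
    ≤-trans (+-monoʳ-≤ (ind (g x)) (distinct-bound g (x ∷ E) v (∧-conicalʳ _ _ d)))
            (≤-reflexive (trans (+-comm (ind (g x)) _) (available-step g E x (∧-conicalˡ _ _ d))))

  -- An injective self-map of Fin n preserves every count: the bound above applies to g and
  -- to its negation, and both sides of the two bounds add up to n.
  injective-cnt : (α : Vec (Fin n) n) → distinct [] α ≡ true → (g : Fin n → Bool) →
                  cnt (g ∘ lookup α) (allFin n) ≡ cnt g (allFin n)
  injective-cnt α d g = ≤-antisym g-bound (+-cancelʳ-≤ (cnt (not ∘ g) (allFin n)) _ _ reverse)
    where
    g-bound : cnt (g ∘ lookup α) (allFin n) ≤ cnt g (allFin n)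
    g-bound = subst (_≤ cnt g (allFin n)) (cnt-toList g α) (distinct-bound g [] α d)
    not-g-bound : cnt (not ∘ g ∘ lookup α) (allFin n) ≤ cnt (not ∘ g) (allFin n)
    not-g-bound = subst (_≤ cnt (not ∘ g) (allFin n)) (cnt-toList (not ∘ g) α) (distinct-bound (not ∘ g) [] α d)
    totals : cnt g (allFin n) + cnt (not ∘ g) (allFin n)
             ≡ cnt (g ∘ lookup α) (allFin n) + cnt (not ∘ g ∘ lookup α) (allFin n)
    totals = trans (cnt-total g (allFin n)) (sym (cnt-total (g ∘ lookup α) (allFin n)))
    reverse : cnt g (allFin n) + cnt (not ∘ g) (allFin n) ≤ cnt (g ∘ lookup α) (allFin n) + cnt (not ∘ g) (allFin n)
    reverse = ≤-trans (≤-reflexive totals) (+-monoʳ-≤ (cnt (g ∘ lookup α) (allFin n)) not-g-bound)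

  notIn-head : ∀ {y x} E → notIn y (x ∷ E) ≡ true → y ≢ x
  notIn-head {y} E e refl with () ← trans (sym (cong (λ b → not b ∧ notIn y E) (eqF-refl y))) e

  notIn-cons : ∀ {y x} E → y ≢ x → notIn y E ≡ true → notIn y (x ∷ E) ≡ true
  notIn-cons E y≢x y∉E rewrite eqF-false y≢x = y∉E

  distinct-sound : ∀ {k} (E : List (Fin n)) (v : Vec (Fin n) k) → distinct E v ≡ true →
                   (∀ i → notIn (lookup v i) E ≡ true) × Injective _≡_ _≡_ (lookup v)
  distinct-sound E []      _ = (λ ()) , λ {i} → ⊥-elim (FinP.¬Fin0 i)
  distinct-sound E (x ∷ v) d = outside , injective
    where
    tail = distinct-sound (x ∷ E) v (∧-conicalʳ _ _ d)
    outside : ∀ i → notIn (lookup (x ∷ v) i) E ≡ true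
    outside zero    = ∧-conicalˡ _ _ d
    outside (suc i) = ∧-conicalʳ _ _ (proj₁ tail i)
    injective : Injective _≡_ _≡_ (lookup (x ∷ v))
    injective {zero}  {zero}  _ = refl
    injective {zero}  {suc j} p = ⊥-elim (notIn-head E (proj₁ tail j) (sym p))
    injective {suc i} {zero}  p = ⊥-elim (notIn-head E (proj₁ tail i) p)
    injective {suc i} {suc j} p = cong suc (proj₂ tail p)

  distinct-complete : ∀ {k} (E : List (Fin n)) (v : Vec (Fin n) k) →
                      (∀ i → notIn (lookup v i) E ≡ true) → Injective _≡_ _≡_ (lookup v) → distinct E v ≡ true
  distinct-complete E []      _       _   = refl
  distinct-complete E (x ∷ v) outside inj =
    ∧-true (outside zero) (distinct-complete (x ∷ E) v outside′ (FinP.suc-injective ∘ inj))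
    where
    outside′ : ∀ i → notIn (lookup v i) (x ∷ E) ≡ true
    outside′ i = notIn-cons E (λ p → FinP.0≢1+n (sym (inj p))) (outside (suc i))

  isPerm≡distinct : (α : Vec (Fin n) n) → does (isPerm? α) ≡ distinct [] α
  isPerm≡distinct α with distinct [] α in d
  ... | true  = dec-true (isPerm? α)
                  (All.tabulate λ {i} _ → All.tabulate λ {j} _ → proj₂ (distinct-sound [] α d) {i} {j})
  ... | false = dec-false (isPerm? α) λ isPerm →
                  let inj : Injective _≡_ _≡_ (lookup α)
                      inj {i} {j} = All.lookup (All.lookup isPerm (∈-allFin i)) (∈-allFin j)
                  in  contradiction (trans (sym (distinct-complete [] α (λ _ → refl) inj)) d) λ ()

  coloured-sound : ∀ (col : Fin n → Bool) {k} (lab : Fin k → Bool) (v : Vec (Fin n) k) →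
                   coloured col (Vec.tabulate lab) v ≡ true → ∀ i → col (lookup v i) ≡ lab i
  coloured-sound col lab (x ∷ v) e zero    = sameAs-sound (lab zero) (∧-conicalˡ _ _ e)
    where
    sameAs-sound : ∀ l {b} → sameAs l b ≡ true → b ≡ l
    sameAs-sound true  {true}  _ = refl
    sameAs-sound false {false} _ = refl
  coloured-sound col lab (x ∷ v) e (suc i) = coloured-sound col (lab ∘ suc) v (∧-conicalʳ _ _ e) i

  coloured-complete : ∀ (col : Fin n → Bool) {k} (lab : Fin k → Bool) (v : Vec (Fin n) k) →
                      (∀ i → col (lookup v i) ≡ lab i) → coloured col (Vec.tabulate lab) v ≡ true
  coloured-complete col lab []      _  = refl
  coloured-complete col lab (x ∷ v) eq =
    ∧-true (subst (λ l → sameAs l (col x) ≡ true) (eq zero) (sameAs-refl (col x)))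
           (coloured-complete col (lab ∘ suc) v (eq ∘ suc))
    where
    sameAs-refl : ∀ b → sameAs b b ≡ true
    sameAs-refl true  = refl
    sameAs-refl false = refl

module Agreement {n : ℕ} (β : Permutation′ n) where

  open Tables {n}

  βf : Fin n → Fin n
  βf i = β ⟨$⟩ʳ i

  fixed moved : Fin n → Bool
  fixed i = eqF (βf i) i
  moved i = not (fixed i)

  fixed-intro : ∀ {i} → βf i ≡ i → fixed i ≡ true
  fixed-intro {i} = dec-true (βf i FinP.≟ i)

  β-injective : ∀ {x y} → βf x ≡ βf y → x ≡ y
  β-injective {x} {y} p = trans (sym (inverseˡ β)) (trans (cong (β ⟨$⟩ˡ_) p) (inverseˡ β))

  moved-image : ∀ {i} → fixed i ≡ false → fixed (βf i) ≡ false
  moved-image {i} fi with βf (βf i) FinP.≟ βf i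
  ... | yes ββi≡βi = contradiction (trans (sym (fixed-intro (β-injective ββi≡βi))) fi) λ ()
  ... | no  _      = refl

  -- The colour pattern moved (sending fixed points to moved ones and vice versa), altered at a
  -- fixed point a, which gets colour true, and at a moved point a′, which gets colour false.
  swapExcept : Fin n → Fin n → Fin n → Bool
  swapExcept a a′ i = if fixed i then eqF i a else not (eqF i a′)

  swapExcept-fixed : ∀ a a′ {i} → fixed i ≡ true → swapExcept a a′ i ≡ eqF i a
  swapExcept-fixed a a′ {i} fi = cong (λ b → if b then eqF i a else not (eqF i a′)) fi

  swapExcept-moved : ∀ a a′ {i} → fixed i ≡ false → swapExcept a a′ i ≡ not (eqF i a′)
  swapExcept-moved a a′ {i} fi = cong (λ b → if b then eqF i a else not (eqF i a′)) fi

  swapExcept-injective : ∀ {a a′ b b′} → fixed a ≡ true → fixed a′ ≡ false →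
                         (∀ i → swapExcept a a′ i ≡ swapExcept b b′ i) → a ≡ b × a′ ≡ b′
  swapExcept-injective {a} {a′} {b} {b′} fa fa′ same = eqF-true atA , eqF-true (not-injective atA′)
    where
    atA : eqF a b ≡ true
    atA = trans (sym (swapExcept-fixed b b′ fa)) (trans (sym (same a)) (trans (swapExcept-fixed a a′ fa) (eqF-refl a)))
    atA′ : not (eqF a′ b′) ≡ not true
    atA′ = trans (sym (swapExcept-moved b b′ fa′)) (trans (sym (same a′)) (trans (swapExcept-moved a a′ fa′) (cong not (eqF-refl a′))))

  module Table (α : Vec (Fin n) n) where

    αf : Fin n → Fin n
    αf = lookup α

    agrees : Fin n → Bool
    agrees i = eqF (αf (βf i)) (βf (αf i))

    colour : Fin n → Bool
    colour i = fixed (αf i)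

    agrees+hamming : cnt agrees (allFin n) + hamming (λ i → αf (βf i)) (λ i → βf (αf i)) ≡ n
    agrees+hamming = trans (cong (cnt agrees (allFin n) +_) (count≡cnt _ (allFin n)))
                           (trans (cnt-total agrees (allFin n)) (length-allFin n))

    kcommute⇔agreements : ∀ {j} → j ≤ n → KCommute (n ∸ j) α β ⇔ cnt agrees (allFin n) ≡ j
    kcommute⇔agreements {j} j≤n = mk⇔ to from
      where
      h : ℕ
      h = hamming (λ i → αf (βf i)) (λ i → βf (αf i))
      to : h ≡ n ∸ j → cnt agrees (allFin n) ≡ j
      to h≡ = +-cancelʳ-≡ (n ∸ j) _ j
                (trans (cong (cnt agrees (allFin n) +_) (sym h≡)) (trans agrees+hamming (sym (m+[n∸m]≡n j≤n))))
      from : cnt agrees (allFin n) ≡ j → h ≡ n ∸ j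
      from e = begin
        h                               ≡⟨ m+n∸m≡n j h ⟨
        j + h ∸ j                       ≡⟨ cong (λ x → x + h ∸ j) e ⟨
        cnt agrees (allFin n) + h ∸ j   ≡⟨ cong (_∸ j) agrees+hamming ⟩
        n ∸ j                           ∎

    agrees-at-fixed : ∀ {i} → fixed i ≡ true → agrees i ≡ colour i
    agrees-at-fixed {i} fi = trans (cong (λ z → eqF (αf z) (βf (αf i))) (eqF-true fi)) (eqF-sym (αf i) (βf (αf i)))

    moved-pair-disagree : ∀ {i} → colour i ≡ false → colour (βf i) ≡ true → agrees i ≡ false
    moved-pair-disagree {i} ci cβi = eqF-false λ p → contradiction (trans (sym cβi) (trans (cong fixed p) (moved-image ci))) λ ()

    module Injective (inj : distinct [] α ≡ true) where

      αf-injective : Injective _≡_ _≡_ αf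
      αf-injective = proj₂ (distinct-sound [] α inj)

      moved-to-fixed-disagree : ∀ {i} → fixed i ≡ false → colour i ≡ true → agrees i ≡ false
      moved-to-fixed-disagree {i} fi ci =
        eqF-false λ p → contradiction (trans (sym (fixed-intro (αf-injective (trans p (eqF-true ci))))) fi) λ ()

      swapping⇒no-agreement : (∀ i → colour i ≡ moved i) → ∀ i → agrees i ≡ false
      swapping⇒no-agreement swap i with fixed i in fi
      ... | true  = trans (agrees-at-fixed fi) (trans (swap i) (cong not fi))
      ... | false = moved-to-fixed-disagree fi (trans (swap i) (cong not fi))

      swapExcept⇒one-agreement : ∀ {a a′} → fixed a ≡ true → (∀ i → colour i ≡ swapExcept a a′ i) →
                              cnt agrees (allFin n) ≡ 1
      swapExcept⇒one-agreement {a} {a′} fa pat = cnt-single agrees a agrees-a unique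
        where
        agrees-a : agrees a ≡ true
        agrees-a = trans (agrees-at-fixed fa) (trans (pat a) (trans (swapExcept-fixed a a′ fa) (eqF-refl a)))
        others : ∀ y → y ≢ a → agrees y ≡ false
        others y y≢a with fixed y in fy
        ... | true = trans (agrees-at-fixed fy) (trans (pat y) (trans (swapExcept-fixed a a′ fy) (eqF-false y≢a)))
        ... | false with y FinP.≟ a′
        ...   | yes refl = moved-pair-disagree
                             (trans (pat y) (trans (swapExcept-moved a a′ fy) (cong not (eqF-refl y))))
                             (trans (pat (βf y)) (trans (swapExcept-moved a a′ (moved-image fy)) (cong not (eqF-false βy≢y))))
          where
          βy≢y : βf y ≢ y
          βy≢y p = contradiction (trans (sym (fixed-intro p)) fy) λ ()
        ...   | no y≢a′ = moved-to-fixed-disagree fy (trans (pat y) (trans (swapExcept-moved a a′ fy) (cong not (eqF-false y≢a′))))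
        unique : ∀ y → agrees y ≡ true → y ≡ a
        unique y ay with y FinP.≟ a
        ... | yes y≡a = y≡a
        ... | no  y≢a = contradiction (trans (sym ay) (others y y≢a)) λ ()

      module Balanced (m : ℕ) (#fixed : cnt fixed (allFin n) ≡ m) (#moved : cnt moved (allFin n) ≡ m) where

        fixedToFixed movedToFixed movedToMoved : ℕ
        fixedToFixed = cnt (λ i → fixed i ∧ colour i) (allFin n)
        movedToFixed = cnt (λ i → moved i ∧ colour i) (allFin n)
        movedToMoved = cnt (λ i → moved i ∧ not (colour i)) (allFin n)

        -- α hits the m fixed points and leaves m points moved, so every fixed point sent to a
        -- fixed point is balanced by a moved point sent to a moved point.
        fixedToFixed≡movedToMoved : fixedToFixed ≡ movedToMoved
        fixedToFixed≡movedToMoved = +-cancelʳ-≡ movedToFixed fixedToFixed movedToMoved (begin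
          fixedToFixed + movedToFixed    ≡⟨ cnt-split fixed colour (allFin n) ⟨
          cnt colour (allFin n)          ≡⟨ injective-cnt α inj fixed ⟩
          cnt fixed (allFin n)           ≡⟨ trans #fixed (sym #moved) ⟩
          cnt moved (allFin n)           ≡⟨ cnt-split colour moved (allFin n) ⟩
          cnt (λ i → colour i ∧ moved i) (allFin n) + cnt (λ i → not (colour i) ∧ moved i) (allFin n)
            ≡⟨ cong₂ _+_ (cnt-cong (λ i → ∧-comm (colour i) (moved i)) (allFin n))
                         (cnt-cong (λ i → ∧-comm (not (colour i)) (moved i)) (allFin n)) ⟩
          movedToFixed + movedToMoved    ≡⟨ +-comm movedToFixed movedToMoved ⟩
          movedToMoved + movedToFixed    ∎)

        no-fixedToFixed⇒swapping : fixedToFixed ≡ 0 → ∀ i → colour i ≡ moved i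
        no-fixedToFixed⇒swapping none i with fixed i in fi
        ... | true  = trans (sym (cong (_∧ colour i) fi))
                            (cnt-zero (λ i → fixed i ∧ colour i) (allFin n) none (∈-allFin i))
        ... | false = not-injective (trans (sym (cong (λ b → not b ∧ not (colour i)) fi))
                       (cnt-zero (λ i → moved i ∧ not (colour i)) (allFin n)
                                 (trans (sym fixedToFixed≡movedToMoved) none) (∈-allFin i)))

        no-agreement⇒swapping : (∀ i → agrees i ≡ false) → ∀ i → colour i ≡ moved i
        no-agreement⇒swapping none = no-fixedToFixed⇒swapping (cnt-none fixedNotFixed (allFin n))
          where
          fixedNotFixed : ∀ i → fixed i ∧ colour i ≡ false
          fixedNotFixed i with fixed i in fi
          ... | true  = trans (sym (agrees-at-fixed fi)) (none i)
          ... | false = refl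

        one-agreement⇒swapExcept : cnt agrees (allFin n) ≡ 1 →
          Σ (Fin n) λ a → Σ (Fin n) λ a′ → fixed a ≡ true × moved a′ ≡ true × (∀ i → colour i ≡ swapExcept a a′ i)
        one-agreement⇒swapExcept once = a , a′ , ∧-conicalˡ _ _ ha , ∧-conicalˡ _ _ ha′ , shape
          where
          atMostOne : fixedToFixed ≤ 1
          atMostOne = subst (fixedToFixed ≤_) once
            (cnt-mono (λ i e → trans (agrees-at-fixed (∧-conicalˡ _ _ e)) (∧-conicalʳ _ _ e)) (allFin n))
          notZero : fixedToFixed ≢ 0
          notZero none = contradiction (trans (sym once) (cnt-none (swapping⇒no-agreement (no-fixedToFixed⇒swapping none)) (allFin n))) λ ()
          exactlyOne : ∀ {k} → k ≤ 1 → k ≢ 0 → k ≡ 1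
          exactlyOne z≤n         k≢0 = contradiction refl k≢0
          exactlyOne (s≤s z≤n)   _   = refl
          ff≡1 : fixedToFixed ≡ 1
          ff≡1 = exactlyOne atMostOne notZero
          mm≡1 : movedToMoved ≡ 1
          mm≡1 = trans (sym fixedToFixed≡movedToMoved) ff≡1
          a a′ : Fin n
          a  = proj₁ (cnt-witness (λ i → fixed i ∧ colour i) (allFin n) ff≡1)
          ha = proj₂ (cnt-witness (λ i → fixed i ∧ colour i) (allFin n) ff≡1)
          a′  = proj₁ (cnt-witness (λ i → moved i ∧ not (colour i)) (allFin n) mm≡1)
          ha′ = proj₂ (cnt-witness (λ i → moved i ∧ not (colour i)) (allFin n) mm≡1)
          shape : ∀ i → colour i ≡ swapExcept a a′ i
          shape i with fixed i in fi
          ... | true  = trans (cong (_∧ colour i) (sym fi))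
                          (cnt≡1-indicator (λ i → fixed i ∧ colour i) ff≡1 ha i)
          ... | false = trans (sym (not-involutive (colour i)))
                          (trans (cong (λ b → not (not b ∧ not (colour i))) (sym fi))
                          (cong not (cnt≡1-indicator (λ i → moved i ∧ not (colour i)) mm≡1 ha′ i)))

  module Counting (m : ℕ) (#fixed : cnt fixed (allFin n) ≡ m) (#moved : cnt moved (allFin n) ≡ m) where

    n≡m+m : n ≡ m + m
    n≡m+m = trans (sym (trans (cnt-total fixed (allFin n)) (length-allFin n))) (cong₂ _+_ #fixed #moved)

    count-patterned : (lab : Fin n → Bool) → cnt lab (allFin n) ≡ m → cnt (not ∘ lab) (allFin n) ≡ m →
                      cnt (λ α → distinct [] α ∧ coloured fixed (Vec.tabulate lab) α) (allVecs n n) ≡ m ! * m !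
    count-patterned lab #true #false = begin
      cnt (λ α → distinct [] α ∧ coloured fixed (Vec.tabulate lab) α) (allVecs n n)
        ≡⟨ count-coloured fixed (Vec.tabulate lab) [] ⟩
      falling (cnt fixed (allFin n)) (cnt id (toList (Vec.tabulate lab)))
        * falling (cnt moved (allFin n)) (cnt not (toList (Vec.tabulate lab)))
        ≡⟨ cong₂ (λ t f → falling (cnt fixed (allFin n)) t * falling (cnt moved (allFin n)) f)
                 (trans (cnt-toList-tabulate id lab) #true) (trans (cnt-toList-tabulate not lab) #false) ⟩
      falling (cnt fixed (allFin n)) m * falling (cnt moved (allFin n)) m
        ≡⟨ cong₂ (λ p q → falling p m * falling q m) #fixed #moved ⟩
      falling m m * falling m m
        ≡⟨ cong₂ _*_ (falling-! m) (falling-! m) ⟩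
      m ! * m !
        ∎

    swapExcept-balanced : ∀ {a a′} → fixed a ≡ true → moved a′ ≡ true →
                          cnt (swapExcept a a′) (allFin n) ≡ m × cnt (not ∘ swapExcept a a′) (allFin n) ≡ m
    swapExcept-balanced {a} {a′} fa ma′ = #true , #false
      where
      onFixed : cnt (λ i → fixed i ∧ swapExcept a a′ i) (allFin n) ≡ 1
      onFixed = cnt-single (λ i → fixed i ∧ swapExcept a a′ i) a
        (∧-true fa (trans (swapExcept-fixed a a′ fa) (eqF-refl a)))
        (λ y e → eqF-true (trans (sym (swapExcept-fixed a a′ (∧-conicalˡ _ _ e))) (∧-conicalʳ _ _ e)))
      onMovedPoint : ∀ i → moved i ∧ swapExcept a a′ i ≡ not (eqF i a′) ∧ moved i
      onMovedPoint i with fixed i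
      ... | true  = sym (∧-zeroʳ (not (eqF i a′)))
      ... | false = sym (∧-identityʳ (not (eqF i a′)))
      movedPart : ℕ
      movedPart = cnt (λ i → moved i ∧ swapExcept a a′ i) (allFin n)
      #movedPart : movedPart + 1 ≡ m
      #movedPart = trans (cong₂ _+_ (cnt-cong onMovedPoint (allFin n)) (cong ind (sym ma′)))
                       (trans (cnt-remove moved a′) #moved)
      #true : cnt (swapExcept a a′) (allFin n) ≡ m
      #true = trans (cnt-split fixed (swapExcept a a′) (allFin n))
                    (trans (cong (_+ movedPart) onFixed) (trans (+-comm 1 movedPart) #movedPart))
      #false : cnt (not ∘ swapExcept a a′) (allFin n) ≡ m
      #false = +-cancelˡ-≡ m _ m (trans (cong (_+ cnt (not ∘ swapExcept a a′) (allFin n)) (sym #true))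
                 (trans (cnt-total (swapExcept a a′) (allFin n)) (trans (length-allFin n) n≡m+m)))

    part1-test : (α : Vec (Fin n) n) →
                 does (isPerm? α) ∧ does (kcommute? n α β) ≡ distinct [] α ∧ coloured fixed (Vec.tabulate moved) α
    part1-test α rewrite isPerm≡distinct α with distinct [] α in inj
    ... | false = refl
    ... | true  = ⇔→≡ (mk⇔ to from)
      where
      open Table α
      open Injective inj
      open Balanced m #fixed #moved
      to : does (kcommute? n α β) ≡ true → coloured fixed (Vec.tabulate moved) α ≡ true
      to e = coloured-complete fixed moved α (no-agreement⇒swapping λ i →
               cnt-zero agrees (allFin n) (Equivalence.to (kcommute⇔agreements z≤n) (does-true (kcommute? n α β) e))
                        (∈-allFin i))
      from : coloured fixed (Vec.tabulate moved) α ≡ true → does (kcommute? n α β) ≡ true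
      from e = dec-true (kcommute? n α β) (Equivalence.from (kcommute⇔agreements z≤n)
                 (cnt-none (swapping⇒no-agreement (coloured-sound fixed moved α e)) (allFin n)))

    part1 : c n β ≡ m ! * m !
    part1 = begin
      c n β
        ≡⟨ count≡cnt (λ α → isPerm? α ×-dec kcommute? n α β) (allVecs n n) ⟩
      cnt (λ α → does (isPerm? α) ∧ does (kcommute? n α β)) (allVecs n n)
        ≡⟨ cnt-cong part1-test (allVecs n n) ⟩
      cnt (λ α → distinct [] α ∧ coloured fixed (Vec.tabulate moved) α) (allVecs n n)
        ≡⟨ count-patterned moved #moved (trans (cnt-cong (not-involutive ∘ fixed) (allFin n)) #fixed) ⟩
      m ! * m !
        ∎

    module Part2 (1≤m : 1 ≤ m) where

      1≤n : 1 ≤ n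
      1≤n = subst (1 ≤_) (sym n≡m+m) (≤-trans 1≤m (m≤m+n m m))

      almostCommutes : Vec (Fin n) n → Bool
      almostCommutes α = does (isPerm? α) ∧ does (kcommute? (n ∸ 1) α β)

      realises : Fin n → Fin n → Vec (Fin n) n → Bool
      realises a a′ α = fixed a ∧ (moved a′ ∧ (distinct [] α ∧ coloured fixed (Vec.tabulate (swapExcept a a′)) α))

      realises-parts : ∀ {a a′ α} → realises a a′ α ≡ true →
                       fixed a ≡ true × moved a′ ≡ true × distinct [] α ≡ true
                       × coloured fixed (Vec.tabulate (swapExcept a a′)) α ≡ true
      realises-parts {a} {a′} {α} e = fa , ma′ , ∧-conicalˡ (distinct [] α) _ r , ∧-conicalʳ (distinct [] α) _ r
        where
        rest = moved a′ ∧ (distinct [] α ∧ coloured fixed (Vec.tabulate (swapExcept a a′)) α)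
        fa  = ∧-conicalˡ (fixed a) rest e
        ma′ = ∧-conicalˡ (moved a′) _ (∧-conicalʳ (fixed a) rest e)
        r   = ∧-conicalʳ (moved a′) _ (∧-conicalʳ (fixed a) rest e)

      almostCommutes⇒realises : ∀ α → almostCommutes α ≡ true →
                                Σ (Fin n) λ a → Σ (Fin n) λ a′ → realises a a′ α ≡ true
      almostCommutes⇒realises α e = fromPattern (one-agreement⇒swapExcept once)
        where
        inj : distinct [] α ≡ true
        inj = trans (sym (isPerm≡distinct α)) (∧-conicalˡ _ _ e)
        open Table α
        open Injective inj
        open Balanced m #fixed #moved
        once : cnt agrees (allFin n) ≡ 1
        once = Equivalence.to (kcommute⇔agreements 1≤n) (does-true (kcommute? (n ∸ 1) α β) (∧-conicalʳ _ _ e))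
        fromPattern : (Σ (Fin n) λ a → Σ (Fin n) λ a′ → fixed a ≡ true × moved a′ ≡ true
                                                     × (∀ i → colour i ≡ swapExcept a a′ i)) →
                      Σ (Fin n) λ a → Σ (Fin n) λ a′ → realises a a′ α ≡ true
        fromPattern (a , a′ , fa , ma′ , shape) =
          a , a′ , ∧-true fa (∧-true ma′ (∧-true inj (coloured-complete fixed (swapExcept a a′) α shape)))

      realises⇒almostCommutes : ∀ {a a′ α} → realises a a′ α ≡ true → almostCommutes α ≡ true
      realises⇒almostCommutes {a} {a′} {α} e with realises-parts {a} {a′} {α} e
      ... | fa , _ , inj , shape =
        ∧-true (trans (isPerm≡distinct α) inj)
               (dec-true (kcommute? (n ∸ 1) α β) (Equivalence.from (kcommute⇔agreements 1≤n)
                 (swapExcept⇒one-agreement fa (coloured-sound fixed (swapExcept a a′) α shape))))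
        where
        open Table α
        open Injective inj

      realises-unique : ∀ {a a′ b b′ α} → realises a a′ α ≡ true → realises b b′ α ≡ true → a ≡ b × a′ ≡ b′
      realises-unique {a} {a′} {b} {b′} {α} e e′ with realises-parts {a} {a′} {α} e | realises-parts {b} {b′} {α} e′
      ... | fa , ma′ , _ , shape | _ , _ , _ , shape′ =
        swapExcept-injective fa (trans (sym (not-involutive (fixed a′))) (cong not ma′))
          (λ i → trans (sym (coloured-sound fixed (swapExcept a a′) α shape i))
                       (coloured-sound fixed (swapExcept b b′) α shape′ i))

      count-realising-fixed : ∀ a → fixed a ≡ true → ∑ (allFin n) (λ a′ → cnt (realises a a′) (allVecs n n)) ≡ m * (m ! * m !)
      count-realising-fixed a fa = trans (∑-indicator moved (m ! * m !) onMoved offMoved (allFin n)) (cong (_* (m ! * m !)) #moved)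
        where
        onMoved : ∀ a′ → moved a′ ≡ true → cnt (realises a a′) (allVecs n n) ≡ m ! * m !
        onMoved a′ ma′ =
          trans (cnt-∧-true _ (allVecs n n) fa) (trans (cnt-∧-true _ (allVecs n n) ma′)
                (count-patterned (swapExcept a a′) (proj₁ balanced) (proj₂ balanced)))
          where balanced = swapExcept-balanced fa ma′
        offMoved : ∀ a′ → moved a′ ≡ false → cnt (realises a a′) (allVecs n n) ≡ 0
        offMoved a′ ma′ = trans (cnt-∧-true _ (allVecs n n) fa) (cnt-∧-false _ (allVecs n n) ma′)

      count-realising-moved : ∀ a → fixed a ≡ false → ∑ (allFin n) (λ a′ → cnt (realises a a′) (allVecs n n)) ≡ 0
      count-realising-moved a fa = ∑-zero (λ a′ → cnt-∧-false _ (allVecs n n) fa) (allFin n)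

      part2 : c (n ∸ 1) β ≡ (m * m) * (m ! * m !)
      part2 = begin
        c (n ∸ 1) β
          ≡⟨ count≡cnt (λ α → isPerm? α ×-dec kcommute? (n ∸ 1) α β) (allVecs n n) ⟩
        cnt almostCommutes (allVecs n n)
          ≡⟨ cnt-partition almostCommutes realises almostCommutes⇒realises realises⇒almostCommutes
                           realises-unique (allVecs n n) ⟩
        ∑ (allFin n) (λ a → ∑ (allFin n) (λ a′ → cnt (realises a a′) (allVecs n n)))
          ≡⟨ ∑-indicator fixed (m * (m ! * m !)) count-realising-fixed count-realising-moved (allFin n) ⟩
        cnt fixed (allFin n) * (m * (m ! * m !))
          ≡⟨ trans (cong (_* (m * (m ! * m !))) #fixed) (sym (*-assoc m m (m ! * m !))) ⟩
        (m * m) * (m ! * m !)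
          ∎

proposition3p6 : (m : ℕ) → 1 ≤ m → (β : Permutation′ (2 * m)) → fixedPoints β ≡ m →
                   (c (2 * m) β ≡ (m !) * (m !)) × (c (2 * m ∸ 1) β ≡ (m * m) * ((m !) * (m !)))
proposition3p6 m 1≤m β fp = part1 , Part2.part2 1≤m
  where
  open Agreement β
  #fixed : cnt fixed (allFin (2 * m)) ≡ m
  #fixed = trans (sym (count≡cnt (λ i → βf i FinP.≟ i) (allFin (2 * m)))) fp
  #moved : cnt moved (allFin (2 * m)) ≡ m
  #moved = +-cancelˡ-≡ m _ m (trans (cong (_+ cnt moved (allFin (2 * m))) (sym #fixed))
             (trans (cnt-total fixed (allFin (2 * m))) (trans (length-allFin (2 * m)) (cong (m +_) (+-identityʳ m)))))
  open Counting m #fixed #moved
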